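{- Let $n\geq r+1$ and $r+1\geq k\geq 4$, and let $H$ be a graph on $k$ vertices (a subgraph of $K_{r+1}$) which does not contain a cycle on $4$ vertices as a subgraph. Then $$\sigma(K_{r+1}-H,n)\geq\begin{cases}(r-1)(2n-r)-3(n-r)-1, & \text{if } n-r \text{ is odd},\\ (r-1)(2n-r)-3(n-r)-2, & \text{if } n-r \text{ is even}.\end{cases}$$
   Context: A sequence $\pi=(d_1,\dots,d_n)$ of nonnegative integers with $d_1\geq\cdots\geq d_n$ is graphic if it is the degree sequence of a simple graph on $n$ vertices (a realization); $\sigma(\pi)=d_1+\cdots+d_n$. $\pi$ is potentially $H$-graphic if some realization contains $H$ as a subgraph. For a subgraph $H$ of $K_m$, $K_m-H$ is $K_m$ with the edges of $H$ deleted. $\sigma(H,n)$ is the smallest even integer $l$ such that every $n$-term graphic sequence $\pi$ with $\sigma(\pi)\geq l$ is potentially $H$-graphic. -}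

module Defs where

open import Data.Nat using (ℕ; zero; suc; _+_; _*_; _∸_; _≤_; _<_; _≥_; _%_; _<?_)
open import Data.Empty using (⊥-elim)
open import Data.Nat.Divisibility using (_∣_)
open import Data.Bool using (Bool; true; false; T; not)
open import Data.Fin using (Fin; toℕ; fromℕ<) renaming (zero to fz; suc to fs)
open import Data.Fin.Properties using (_≟_)
open import Data.Vec using (Vec; lookup; count)
import Data.Vec
open import Data.Vec.Functional using () renaming (Vector to FVec)
open import Data.List using (List; filter; length; allFin)
open import Data.Product using (Σ; _×_; _,_; ∃)
open import Relation.Binary.PropositionalEquality using (_≡_; _≢_; refl; cong) renaming (sym to ≡-sym)
open import Relation.Nullary using (¬_; Dec; yes; no)
open import Function.Definitions using (Injective)

record Graph (n : ℕ) : Set where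
  field
    adj   : Fin n → Fin n → Bool
    sym   : ∀ i j → adj i j ≡ adj j i
    irrefl : ∀ i → adj i i ≡ false
open Graph public

deg : ∀ {n} → Graph n → Fin n → ℕ
deg {n} G i = length (filter (λ j → Data.Bool._≟_ (adj G i j) true) (allFin n))

σ : ∀ {n} → Vec ℕ n → ℕ
σ = Data.Vec.sum

Nonincreasing : ∀ {n} → Vec ℕ n → Set
Nonincreasing {n} π = ∀ (i j : Fin n) → toℕ i ≤ toℕ j → lookup π j ≤ lookup π i

-- G is a realization of π: vertex i of G has degree d_{i+1}.
Realizes : ∀ {n} → Graph n → Vec ℕ n → Set
Realizes {n} G π = ∀ (i : Fin n) → deg G i ≡ lookup π i

Graphic : ∀ {n} → Vec ℕ n → Set
Graphic {n} π = Nonincreasing π × Σ (Graph n) (λ G → Realizes G π)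

SubgraphOf : ∀ {m n} → Graph m → Graph n → Set
SubgraphOf {m} {n} H G =
  Σ (Fin m → Fin n) λ f → Injective _≡_ _≡_ f ×
    (∀ i j → T (adj H i j) → T (adj G (f i) (f j)))

PotentiallyGraphic : ∀ {m n} → Graph m → Vec ℕ n → Set
PotentiallyGraphic {m} {n} H π =
  Σ (Graph n) λ G → Realizes G π × SubgraphOf H G

SigmaProp : ∀ {m} → Graph m → ℕ → ℕ → Set
SigmaProp H n l = ∀ (π : Vec ℕ n) → Graphic π → σ π ≥ l → PotentiallyGraphic H π

-- "σ(H,n) ≥ b": every even l with SigmaProp H n l satisfies l ≥ b
-- (σ(H,n) is the least such even l).
SigmaGeq : ∀ {m} → Graph m → ℕ → ℕ → Set
SigmaGeq H n b = ∀ (l : ℕ) → 2 ∣ l → SigmaProp H n l → b ≤ l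

C4 : Graph 4
C4 = record { adj = a ; sym = s ; irrefl = ir }
  where
  a : Fin 4 → Fin 4 → Bool
  a fz (fs fz) = true
  a (fs fz) fz = true
  a (fs fz) (fs (fs fz)) = true
  a (fs (fs fz)) (fs fz) = true
  a (fs (fs fz)) (fs (fs (fs fz))) = true
  a (fs (fs (fs fz))) (fs (fs fz)) = true
  a (fs (fs (fs fz))) fz = true
  a fz (fs (fs (fs fz))) = true
  a _ _ = false
  s : ∀ i j → a i j ≡ a j i
  s fz fz = refl
  s fz (fs fz) = refl
  s fz (fs (fs fz)) = refl
  s fz (fs (fs (fs fz))) = refl
  s (fs fz) fz = refl
  s (fs fz) (fs fz) = refl
  s (fs fz) (fs (fs fz)) = refl
  s (fs fz) (fs (fs (fs fz))) = refl
  s (fs (fs fz)) fz = refl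
  s (fs (fs fz)) (fs fz) = refl
  s (fs (fs fz)) (fs (fs fz)) = refl
  s (fs (fs fz)) (fs (fs (fs fz))) = refl
  s (fs (fs (fs fz))) fz = refl
  s (fs (fs (fs fz))) (fs fz) = refl
  s (fs (fs (fs fz))) (fs (fs fz)) = refl
  s (fs (fs (fs fz))) (fs (fs (fs fz))) = refl
  ir : ∀ i → a i i ≡ false
  ir fz = refl
  ir (fs fz) = refl
  ir (fs (fs fz)) = refl
  ir (fs (fs (fs fz))) = refl

ContainsC4 : ∀ {k} → Graph k → Set
ContainsC4 H = SubgraphOf C4 H

-- K_{r+1} - H, where H is a graph on k ≤ r+1 vertices, viewed as a
-- subgraph of K_{r+1} on the vertices 0..k-1 (vertex i of H is vertex
-- i of K_{r+1}).
module _ {k m : ℕ} (H : Graph k) where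
  private
    hadj : (i j : Fin m) → Dec (toℕ i < k) → Dec (toℕ j < k) → Bool
    hadj i j (yes p) (yes q) = adj H (fromℕ< p) (fromℕ< q)
    hadj i j _ _ = false

    hsym : ∀ i j (di : Dec (toℕ i < k)) (dj : Dec (toℕ j < k)) → hadj i j di dj ≡ hadj j i dj di
    hsym i j (yes p) (yes q) = Graph.sym H (fromℕ< p) (fromℕ< q)
    hsym i j (yes p) (no q) = refl
    hsym i j (no p) (yes q) = refl
    hsym i j (no p) (no q) = refl

    inH : Fin m → Fin m → Bool
    inH i j = hadj i j (toℕ i <? k) (toℕ j <? k)

    dadj : Fin m → Fin m → Bool
    dadj i j with i ≟ j
    ... | yes _ = false
    ... | no _ = not (inH i j)

    dsym : ∀ i j → dadj i j ≡ dadj j i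
    dsym i j with i ≟ j | j ≟ i
    ... | yes _ | yes _ = refl
    ... | yes e | no n = ⊥-elim (n (≡-sym e))
    ... | no n | yes e = ⊥-elim (n (≡-sym e))
    ... | no _ | no _ = cong not (hsym i j (toℕ i <? k) (toℕ j <? k))

    dirr : ∀ i → dadj i i ≡ false
    dirr i with i ≟ i
    ... | yes _ = refl
    ... | no n = ⊥-elim (n refl)

  KminusH : Graph m
  KminusH = record { adj = dadj ; sym = dsym ; irrefl = dirr }

module Submission where

-- Write r = 3 + s and n = s + m, and let π be the degree sequence of K_s ∨ M, where M is a maximum
-- matching on m vertices. In a realization of π the s vertices of degree n − 1 are adjacent to
-- everything, so every other vertex has at most one neighbour outside them. An embedding of
-- K_{r+1} − H, which has s + 4 vertices, therefore sends four of its vertices outside them, and these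
-- four induce a subgraph of maximum degree at most one in K_{r+1} − H. Each of them is then a vertex
-- of H, and the complement of that subgraph, which lies in H, contains a 4-cycle. So π is a graphic
-- sequence that is not potentially (K_{r+1} − H)-graphic; as σ(π) is even, σ(K_{r+1} − H, n) ≥ σ(π) + 2,
-- and σ(π) + 2 is exactly the stated bound.

open import Defs
open import Data.Bool using (Bool; true; false; T; not; if_then_else_) renaming (_≟_ to _≟ᵇ_)
open import Data.Bool.Properties using (T?)
open import Data.Empty using (⊥; ⊥-elim)
open import Data.Fin using (Fin; zero; suc; toℕ; fromℕ<; punchIn; punchOut; _↑ˡ_; _↑ʳ_; splitAt)
open import Data.Fin.Patterns using (0F; 1F; 2F; 3F)
open import Data.Fin.Permutation.Components using (transpose; transpose-inverse)
open import Data.Fin.Properties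
  using (_≟_; suc-injective; 0≢1+n; punchIn-punchOut; punchOut-injective; punchInᵢ≢i; punchIn-injective;
         toℕ-injective; fromℕ<-injective; splitAt-↑ˡ; splitAt-↑ʳ; toℕ-↑ˡ; toℕ-↑ʳ; toℕ<n)
import Data.List as List
open import Data.Nat using (ℕ; zero; suc; 2+; _+_; _*_; _∸_; _≤_; _<_; _≥_; _%_; z≤n; s≤s; s≤s⁻¹; _≤?_; _<?_)
open import Data.Nat.DivMod using (%-distribˡ-+)
open import Data.Nat.Divisibility using (_∣_; divides; ∣m∣n⇒∣m+n; m∣m*n; _∣0)
open import Data.Nat.Properties
  using (+-suc; +-assoc; +-comm; +-identityʳ; +-commutativeSemigroup; +-monoʳ-≤; +-monoˡ-≤; +-cancelˡ-≤; +-cancelʳ-≤;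
         *-monoˡ-≤; *-cancelʳ-<; ≤-refl; ≤-reflexive; ≤-trans; ≰⇒>; <⇒≱; 1+n≰n; m≤n⇒m≤1+n; m≤m+n; m+n≤o⇒m≤o;
         m≤n⇒∃[o]m+o≡n; m+n∸n≡m; m+n∸m≡n; [m+n]∸[m+o]≡n∸o; module ≤-Reasoning)
import Data.Nat.Properties as ℕ
open import Data.Nat.Tactic.RingSolver using (solve-∀)
open import Algebra.Properties.CommutativeSemigroup +-commutativeSemigroup using (x∙yz≈y∙xz; interchange)
open import Data.Product using (Σ; ∃; _×_; _,_)
open import Data.Sum using (_⊎_; inj₁; inj₂; [_,_]′)
open import Data.Vec using (Vec; []; _∷_; lookup; tabulate; _++_; map; replicate; sum)
open import Data.Vec.Properties
  using (tabulate∘lookup; tabulate-cong; lookup-++ˡ; lookup-++ʳ; lookup-map; lookup-replicate; sum-++)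
import Data.Vec.Functional as Vector
open import Function using (_∘_; id; const)
open import Function.Definitions using (Injective)
open import Relation.Binary.PropositionalEquality renaming (sym to ≡-sym)
open import Relation.Nullary using (¬_; Dec; yes; no; does)
open import Relation.Nullary.Decidable using (dec-true; dec-false)

count : ∀ {n} → (Fin n → Bool) → ℕ
count {zero}  P = 0
count {suc n} P = if P zero then suc (count (P ∘ suc)) else count (P ∘ suc)

count-cong : ∀ {n} {P Q : Fin n → Bool} → P ≗ Q → count P ≡ count Q
count-cong {zero}  P≗Q = refl
count-cong {suc n} P≗Q rewrite P≗Q zero | count-cong (P≗Q ∘ suc) = refl

count-all : ∀ {n} (P : Fin n → Bool) → (∀ i → T (P i)) → count P ≡ n
count-all {zero}  P all = refl
count-all {suc n} P all with P zero | all zero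
... | true | _ = cong suc (count-all (P ∘ suc) (all ∘ suc))

count-none : ∀ {n} (P : Fin n → Bool) → (∀ i → ¬ T (P i)) → count P ≡ 0
count-none {zero}  P none = refl
count-none {suc n} P none with P zero | none zero
... | true  | ¬P₀ = ⊥-elim (¬P₀ _)
... | false | _   = count-none (P ∘ suc) (none ∘ suc)

count≤n : ∀ {n} (P : Fin n → Bool) → count P ≤ n
count≤n {zero}  P = z≤n
count≤n {suc n} P with P zero
... | true  = s≤s (count≤n (P ∘ suc))
... | false = m≤n⇒m≤1+n (count≤n (P ∘ suc))

count≡n⇒all : ∀ {n} (P : Fin n → Bool) → count P ≡ n → ∀ i → T (P i)
count≡n⇒all {suc n} P full i with P zero in P₀
... | false = ⊥-elim (1+n≰n (subst (_≤ n) full (count≤n (P ∘ suc))))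
count≡n⇒all {suc n} P full zero    | true rewrite P₀ = _
count≡n⇒all {suc n} P full (suc i) | true = count≡n⇒all (P ∘ suc) (ℕ.suc-injective full) i

count-punchIn : ∀ {n} (P : Fin (suc n) → Bool) i →
  count P ≡ (if P i then suc (count (P ∘ punchIn i)) else count (P ∘ punchIn i))
count-punchIn         P zero    = refl
count-punchIn {suc n} P (suc i) rewrite count-punchIn (P ∘ suc) i with P zero | P (suc i)
... | true  | true  = refl
... | true  | false = refl
... | false | true  = refl
... | false | false = refl

count-punchIn-true : ∀ {n} (P : Fin (suc n) → Bool) {i} → T (P i) → count P ≡ suc (count (P ∘ punchIn i))
count-punchIn-true P {i} Pᵢ with P i | count-punchIn P i
... | true | eq = eq

count-punchIn-false : ∀ {n} (P : Fin (suc n) → Bool) {i} → P i ≡ false → count P ≡ count (P ∘ punchIn i)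
count-punchIn-false P {i} Pᵢ with P i | count-punchIn P i
... | false | eq = eq

1≤count : ∀ {n} (P : Fin n → Bool) {i} → T (P i) → 1 ≤ count P
1≤count {suc n} P Pᵢ rewrite count-punchIn-true P Pᵢ = s≤s z≤n

2≤count : ∀ {n} (P : Fin n → Bool) {i j} → i ≢ j → T (P i) → T (P j) → 2 ≤ count P
2≤count {suc n} P {i} {j} i≢j Pᵢ Pⱼ rewrite count-punchIn-true P Pᵢ =
  s≤s (1≤count (P ∘ punchIn i) (subst (T ∘ P) (≡-sym (punchIn-punchOut i≢j)) Pⱼ))

count-split : ∀ s {m} (P : Fin (s + m) → Bool) → count P ≡ count (P ∘ (_↑ˡ m)) + count (P ∘ (s ↑ʳ_))
count-split zero    P = refl
count-split (suc s) P with P zero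
... | true  = cong suc (count-split s (P ∘ suc))
... | false = count-split s (P ∘ suc)

count-complement : ∀ {n} (P : Fin n → Bool) → count P + count (not ∘ P) ≡ n
count-complement {zero}  P = refl
count-complement {suc n} P with P zero
... | true  = cong suc (count-complement (P ∘ suc))
... | false = trans (+-suc _ _) (cong suc (count-complement (P ∘ suc)))

count-∘-injective : ∀ {N n} (P : Fin n → Bool) (f : Fin N → Fin n) → Injective _≡_ _≡_ f →
  count (P ∘ f) ≤ count P
count-∘-injective {zero}          P f f-inj = z≤n
count-∘-injective {suc N} {zero}  P f f-inj with f zero
... | ()
count-∘-injective {suc N} {suc n} P f f-inj =
  ≤-trans (if-suc-mono (P (f zero)) rest) (≤-reflexive (≡-sym (count-punchIn P (f zero))))
  where
  f₀≢ : ∀ i → f zero ≢ f (suc i)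
  f₀≢ i = 0≢1+n ∘ f-inj
  g : Fin N → Fin n
  g i = punchOut (f₀≢ i)
  g-inj : Injective _≡_ _≡_ g
  g-inj gᵢ≡gⱼ = suc-injective (f-inj (punchOut-injective (f₀≢ _) (f₀≢ _) gᵢ≡gⱼ))
  rest : count (P ∘ f ∘ suc) ≤ count (P ∘ punchIn (f zero))
  rest = begin
    count (P ∘ f ∘ suc)                 ≡⟨ count-cong (λ i → cong P (≡-sym (punchIn-punchOut (f₀≢ i)))) ⟩
    count (P ∘ punchIn (f zero) ∘ g)    ≤⟨ count-∘-injective (P ∘ punchIn (f zero)) g g-inj ⟩
    count (P ∘ punchIn (f zero))        ∎
    where open ≤-Reasoning
  if-suc-mono : ∀ b {x y} → x ≤ y → (if b then suc x else x) ≤ (if b then suc y else y)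
  if-suc-mono true  = s≤s
  if-suc-mono false = id

count-choose : ∀ {n} c (P : Fin n → Bool) → c ≤ count P →
  Σ (Fin c → Fin n) λ y → Injective _≡_ _≡_ y × (∀ i → T (P (y i)))
count-choose zero P _ = (λ ()) , (λ { {()} }) , (λ ())
count-choose {suc n} (suc c) P 1+c≤count with P zero in P₀
... | true  with y , y-inj , P∘y ← count-choose c (P ∘ suc) (s≤s⁻¹ 1+c≤count) =
  (zero Vector.∷ suc ∘ y) , inj , λ { zero → subst T (≡-sym P₀) _ ; (suc i) → P∘y i }
  where
  inj : Injective _≡_ _≡_ (zero Vector.∷ suc ∘ y)
  inj {zero}  {zero}  _ = refl
  inj {suc i} {suc j} e = cong suc (y-inj (suc-injective e))
... | false with y , y-inj , P∘y ← count-choose (suc c) (P ∘ suc) 1+c≤count =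
  suc ∘ y , y-inj ∘ suc-injective , P∘y

deg≡count : ∀ {n} (G : Graph n) v → deg G v ≡ count (adj G v)
deg≡count {n} G v = length-filter-tabulate (adj G v) id
  where
  length-filter-tabulate : ∀ {m} (P : Fin n → Bool) (g : Fin m → Fin n) →
    List.length (List.filter (λ j → P j ≟ᵇ true) (List.tabulate g)) ≡ count (P ∘ g)
  length-filter-tabulate {zero}  P g = refl
  length-filter-tabulate {suc m} P g with P (g zero)
  ... | true  = cong suc (length-filter-tabulate P (g ∘ suc))
  ... | false = length-filter-tabulate P (g ∘ suc)

deg≡n∸1⇒adjacent : ∀ {n} (G : Graph n) {v w} → deg G v ≡ n ∸ 1 → v ≢ w → T (adj G v w)
deg≡n∸1⇒adjacent {suc n} G {v} {w} deg≡n v≢w =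
  subst (T ∘ adj G v) (punchIn-punchOut v≢w) (count≡n⇒all (adj G v ∘ punchIn v) full (punchOut v≢w))
  where
  full : count (adj G v ∘ punchIn v) ≡ n
  full = trans (≡-sym (count-punchIn-false (adj G v) (irrefl G v))) (trans (≡-sym (deg≡count G v)) deg≡n)

delete₀ : ∀ {n} → Graph (suc n) → Graph n
delete₀ G = record
  { adj    = λ i j → adj G (suc i) (suc j)
  ; sym    = λ i j → sym G (suc i) (suc j)
  ; irrefl = irrefl G ∘ suc
  }

sum-tabulate-if : ∀ {n} (P : Fin n → Bool) (f : Fin n → ℕ) →
  sum (tabulate (λ i → if P i then suc (f i) else f i)) ≡ count P + sum (tabulate f)
sum-tabulate-if {zero}  P f = refl
sum-tabulate-if {suc n} P f with P zero
... | true  = cong suc (trans (cong (f zero +_) (sum-tabulate-if (P ∘ suc) (f ∘ suc)))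
                             (x∙yz≈y∙xz (f zero) (count (P ∘ suc)) _))
... | false = trans (cong (f zero +_) (sum-tabulate-if (P ∘ suc) (f ∘ suc)))
                    (x∙yz≈y∙xz (f zero) (count (P ∘ suc)) _)

degree-sum-even : ∀ {n} (G : Graph n) → 2 ∣ sum (tabulate (count ∘ adj G))
degree-sum-even {zero}  G = 2 ∣0
degree-sum-even {suc n} G = subst (2 ∣_) (≡-sym double) (∣m∣n⇒∣m+n (m∣m*n c) (degree-sum-even (delete₀ G)))
  where
  c : ℕ
  c = count (adj G zero ∘ suc)
  rest : ℕ
  rest = sum (tabulate (count ∘ adj (delete₀ G)))
  double : sum (tabulate (count ∘ adj G)) ≡ 2 * c + rest
  double = begin
    count (adj G zero) + sum (tabulate (λ i → count (adj G (suc i))))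
      ≡⟨ cong₂ _+_ (count-punchIn-false (adj G zero) (irrefl G zero))
                   (sum-tabulate-if (λ i → adj G (suc i) zero) (count ∘ adj (delete₀ G))) ⟩
    c + (count (λ i → adj G (suc i) zero) + rest)
      ≡⟨ cong (λ x → c + (x + rest)) (count-cong (λ i → sym G (suc i) zero)) ⟩
    c + (c + rest)        ≡⟨ +-assoc c c rest ⟨
    c + c + rest          ≡⟨ cong (λ x → c + x + rest) (+-identityʳ c) ⟨
    2 * c + rest          ∎
    where open ≡-Reasoning

σ-even : ∀ {n} {π : Vec ℕ n} {G : Graph n} → Realizes G π → 2 ∣ σ π
σ-even {π = π} {G} G-realizes = subst (2 ∣_) (cong sum (≡-sym π≡degrees)) (degree-sum-even G)
  where
  π≡degrees : π ≡ tabulate (count ∘ adj G)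
  π≡degrees = trans (≡-sym (tabulate∘lookup π))
                    (tabulate-cong (λ v → trans (≡-sym (G-realizes v)) (deg≡count G v)))

even<even⇒2+≤ : ∀ {a b} → 2 ∣ a → 2 ∣ b → a < b → 2 + a ≤ b
even<even⇒2+≤ (divides x refl) (divides y refl) a<b = *-monoˡ-≤ 2 (*-cancelʳ-< 2 x y a<b)

non-potential⇒SigmaGeq : ∀ {k n} {H : Graph k} {π : Vec ℕ n} →
  Graphic π → ¬ PotentiallyGraphic H π → SigmaGeq H n (2 + σ π)
non-potential⇒SigmaGeq {π = π} π-graphic@(_ , G , G-realizes) π-avoids l 2∣l l-forces with l ≤? σ π
... | yes l≤σ = ⊥-elim (π-avoids (l-forces π π-graphic l≤σ))
... | no  l≰σ = even<even⇒2+≤ (σ-even {π = π} {G = G} G-realizes) 2∣l (≰⇒> l≰σ)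

-- Four-cycles in the complement of a sparse quadruple

MaxDegree≤1On : ∀ {n} → Graph n → (Fin n → Set) → Set
MaxDegree≤1On G S = ∀ {u v w} → S u → S v → S w → v ≢ w → T (adj G u v) → T (adj G u w) → ⊥

MaxDegree≤1On-pullback : ∀ {m n} {F : Graph m} {G : Graph n} {S : Fin n → Set} →
  ((f , _ , _) : SubgraphOf F G) → MaxDegree≤1On G S → MaxDegree≤1On F (S ∘ f)
MaxDegree≤1On-pullback (f , f-inj , f-edge) sparse u∈S v∈S w∈S v≢w uv uw =
  sparse u∈S v∈S w∈S (v≢w ∘ f-inj) (f-edge _ _ uv) (f-edge _ _ uw)

AroundCycle : (Fin 4 → Fin 4 → Set) → Set
AroundCycle R = R 0F 1F × R 1F 2F × R 2F 3F × R 3F 0F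

AroundCycle-map : ∀ {R S : Fin 4 → Fin 4 → Set} → (∀ {t u} → t ≢ u → R t u → S t u) →
  AroundCycle R → AroundCycle S
AroundCycle-map f (r₀₁ , r₁₂ , r₂₃ , r₃₀) =
  f (λ ()) r₀₁ , f (λ ()) r₁₂ , f (λ ()) r₂₃ , f (λ ()) r₃₀

cycle⇒ContainsC4 : ∀ {n} (G : Graph n) (v : Fin 4 → Fin n) → Injective _≡_ _≡_ v →
  AroundCycle (λ t u → T (adj G (v t) (v u))) → ContainsC4 G
cycle⇒ContainsC4 G v v-inj (a₀₁ , a₁₂ , a₂₃ , a₃₀) = v , v-inj , edge
  where
  back : ∀ {t u} → T (adj G (v t) (v u)) → T (adj G (v u) (v t))
  back {t} {u} = subst T (sym G (v t) (v u))
  edge : ∀ t u → T (adj C4 t u) → T (adj G (v t) (v u))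
  edge 0F 1F _ = a₀₁
  edge 1F 2F _ = a₁₂
  edge 2F 3F _ = a₂₃
  edge 3F 0F _ = a₃₀
  edge 1F 0F _ = back a₀₁
  edge 2F 1F _ = back a₁₂
  edge 3F 2F _ = back a₂₃
  edge 0F 3F _ = back a₃₀
  edge 0F 0F ()
  edge 0F 2F ()
  edge 1F 1F ()
  edge 1F 3F ()
  edge 2F 0F ()
  edge 2F 2F ()
  edge 3F 1F ()
  edge 3F 3F ()

transpose-injective : ∀ {n} (i j : Fin n) → Injective _≡_ _≡_ (transpose i j)
transpose-injective i j eq =
  trans (≡-sym (transpose-inverse j i)) (trans (cong (transpose j i) eq) (transpose-inverse j i))

-- A graph on four vertices of maximum degree at most one lies in a perfect matching, and the
-- complement of a perfect matching is a 4-cycle: one of 0123, 0213 and 0132.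
sparse⇒complement-cycle : (e : Fin 4 → Fin 4 → Bool) → (∀ i j → e i j ≡ e j i) →
  (∀ {i j l} → j ≢ l → T (e i j) → T (e i l) → ⊥) →
  Σ (Fin 4 → Fin 4) λ τ → Injective _≡_ _≡_ τ × AroundCycle (λ t u → ¬ T (e (τ t) (τ u)))
sparse⇒complement-cycle e e-sym ≤1 =
  cases (T? (e 0F 1F)) (T? (e 0F 2F)) (T? (e 0F 3F)) (T? (e 1F 2F)) (T? (e 1F 3F))
  where
  Result : Set
  Result = Σ (Fin 4 → Fin 4) λ τ → Injective _≡_ _≡_ τ × AroundCycle (λ t u → ¬ T (e (τ t) (τ u)))
  only : ∀ {i j l} → T (e i j) → j ≢ l → ¬ T (e i l)
  only eᵢⱼ j≢l eᵢₗ = ≤1 j≢l eᵢⱼ eᵢₗ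
  flip : ∀ {i j} → T (e i j) → T (e j i)
  flip {i} {j} = subst T (e-sym i j)
  flip¬ : ∀ {i j} → ¬ T (e i j) → ¬ T (e j i)
  flip¬ = _∘ flip
  cycle-0123 : ¬ T (e 0F 1F) → ¬ T (e 1F 2F) → ¬ T (e 2F 3F) → ¬ T (e 3F 0F) → Result
  cycle-0123 n₀₁ n₁₂ n₂₃ n₃₀ = id , id , n₀₁ , n₁₂ , n₂₃ , n₃₀
  cycle-0213 : ¬ T (e 0F 2F) → ¬ T (e 2F 1F) → ¬ T (e 1F 3F) → ¬ T (e 3F 0F) → Result
  cycle-0213 n₀₂ n₂₁ n₁₃ n₃₀ = transpose 1F 2F , transpose-injective 1F 2F , n₀₂ , n₂₁ , n₁₃ , n₃₀
  cycle-0132 : ¬ T (e 0F 1F) → ¬ T (e 1F 3F) → ¬ T (e 3F 2F) → ¬ T (e 2F 0F) → Result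
  cycle-0132 n₀₁ n₁₃ n₃₂ n₂₀ = transpose 2F 3F , transpose-injective 2F 3F , n₀₁ , n₁₃ , n₃₂ , n₂₀
  cases : Dec (T (e 0F 1F)) → Dec (T (e 0F 2F)) → Dec (T (e 0F 3F)) →
          Dec (T (e 1F 2F)) → Dec (T (e 1F 3F)) → Result
  cases (yes a₀₁) _ _ _ _ =
    cycle-0213 (only a₀₁ (λ ())) (flip¬ (only (flip a₀₁) (λ ())))
               (only (flip a₀₁) (λ ())) (flip¬ (only a₀₁ (λ ())))
  cases (no n₀₁) (yes a₀₂) _ _ _ =
    cycle-0123 n₀₁ (flip¬ (only (flip a₀₂) (λ ()))) (only (flip a₀₂) (λ ())) (flip¬ (only a₀₂ (λ ())))
  cases (no n₀₁) (no n₀₂) (yes a₀₃) _ _ =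
    cycle-0132 n₀₁ (flip¬ (only (flip a₀₃) (λ ()))) (only (flip a₀₃) (λ ())) (flip¬ n₀₂)
  cases (no n₀₁) (no n₀₂) (no n₀₃) (yes a₁₂) _ =
    cycle-0132 n₀₁ (only a₁₂ (λ ())) (flip¬ (only (flip a₁₂) (λ ()))) (flip¬ n₀₂)
  cases (no n₀₁) (no n₀₂) (no n₀₃) (no n₁₂) (yes a₁₃) =
    cycle-0123 n₀₁ n₁₂ (flip¬ (only (flip a₁₃) (λ ()))) (flip¬ n₀₃)
  cases (no n₀₁) (no n₀₂) (no n₀₃) (no n₁₂) (no n₁₃) =
    cycle-0213 n₀₂ (flip¬ n₁₂) n₁₃ (flip¬ n₀₃)

module _ {k N : ℕ} (H : Graph k) where

  KminusH-adjacent-outside-H : ∀ {x y : Fin N} → x ≢ y → ¬ toℕ x < k → T (adj (KminusH H) x y)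
  KminusH-adjacent-outside-H {x} {y} x≢y x∉H with x ≟ y
  ... | yes x≡y = ⊥-elim (x≢y x≡y)
  ... | no _ with toℕ x <? k
  ... | yes x∈H = ⊥-elim (x∉H x∈H)
  ... | no _ = _

  KminusH-nonadjacent⇒H-adjacent : ∀ {x y : Fin N} → x ≢ y → (x∈H : toℕ x < k) (y∈H : toℕ y < k) →
    ¬ T (adj (KminusH H) x y) → T (adj H (fromℕ< x∈H) (fromℕ< y∈H))
  KminusH-nonadjacent⇒H-adjacent {x} {y} x≢y x∈H y∈H x≁y with x ≟ y
  ... | yes x≡y = ⊥-elim (x≢y x≡y)
  ... | no _ with toℕ x <? k | toℕ y <? k
  ... | no x∉H | _      = ⊥-elim (x∉H x∈H)
  ... | yes _  | no y∉H = ⊥-elim (y∉H y∈H)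
  ... | yes _  | yes _ with adj H (fromℕ< x∈H) (fromℕ< y∈H)
  ...   | true  = _
  ...   | false = x≁y _

  module _ (y : Fin 4 → Fin N) (y-inj : Injective _≡_ _≡_ y) {S : Fin N → Set} (y∈S : ∀ i → S (y i))
           (sparse : MaxDegree≤1On (KminusH H) S) where

    private
      F : Graph N
      F = KminusH H

      sparse-y : ∀ {i j l} → j ≢ l → T (adj F (y i) (y j)) → T (adj F (y i) (y l)) → ⊥
      sparse-y j≢l = sparse (y∈S _) (y∈S _) (y∈S _) (j≢l ∘ y-inj)

      -- A vertex outside H is adjacent in K_N − H to every other vertex, in particular to two of the y's.
      y∈H : ∀ i → toℕ (y i) < k
      y∈H i with toℕ (y i) <? k
      ... | yes yᵢ∈H = yᵢ∈H
      ... | no  yᵢ∉H =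
        ⊥-elim (sparse-y j≢l (KminusH-adjacent-outside-H (i≢ 0F) yᵢ∉H) (KminusH-adjacent-outside-H (i≢ 1F) yᵢ∉H))
        where
        i≢ : ∀ j → y i ≢ y (punchIn i j)
        i≢ j = punchInᵢ≢i i j ∘ ≡-sym ∘ y-inj
        j≢l : punchIn i 0F ≢ punchIn i 1F
        j≢l = (λ ()) ∘ punchIn-injective i 0F 1F

    KminusH-sparse⇒C4 : ContainsC4 H
    KminusH-sparse⇒C4
      with τ , τ-inj , co-cycle ←
             sparse⇒complement-cycle (λ i j → adj F (y i) (y j)) (λ i j → sym F (y i) (y j)) sparse-y
      = cycle⇒ContainsC4 H c c-inj (AroundCycle-map edge co-cycle)
      where
      c : Fin 4 → Fin k
      c t = fromℕ< (y∈H (τ t))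
      c-inj : Injective _≡_ _≡_ c
      c-inj eq = τ-inj (y-inj (toℕ-injective (fromℕ<-injective _ _ (y∈H _) (y∈H _) eq)))
      edge : ∀ {t u} → t ≢ u → ¬ T (adj F (y (τ t)) (y (τ u))) → T (adj H (c t) (c u))
      edge t≢u = KminusH-nonadjacent⇒H-adjacent (t≢u ∘ τ-inj ∘ y-inj) (y∈H _) (y∈H _)

-- The extremal graph K_s ∨ M and its degree sequence

data SplitView (s : ℕ) {m : ℕ} : Fin (s + m) → Set where
  left  : (a : Fin s) → SplitView s (a ↑ˡ m)
  right : (b : Fin m) → SplitView s (s ↑ʳ b)

splitView : ∀ s {m} (i : Fin (s + m)) → SplitView s i
splitView zero    i       = right i
splitView (suc s) zero    = left zero
splitView (suc s) (suc i) with splitView s i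
... | left a  = left (suc a)
... | right b = right b

complete : (s : ℕ) → Graph s
complete s = record
  { adj    = λ i j → not (does (i ≟ j))
  ; sym    = distinct-sym
  ; irrefl = λ i → cong not (dec-true (i ≟ i) refl)
  }
  where
  distinct-sym : ∀ i j → not (does (i ≟ j)) ≡ not (does (j ≟ i))
  distinct-sym i j with i ≟ j | j ≟ i
  ... | yes _   | yes _   = refl
  ... | no _    | no _    = refl
  ... | yes i≡j | no j≢i  = ⊥-elim (j≢i (≡-sym i≡j))
  ... | no i≢j  | yes j≡i = ⊥-elim (i≢j (≡-sym j≡i))

complete-realizes : ∀ s → Realizes (complete s) (replicate s (s ∸ 1))
complete-realizes (suc s) a = begin
  deg K a                      ≡⟨ deg≡count K a ⟩
  count (adj K a)              ≡⟨ count-punchIn-false (adj K a) (irrefl K a) ⟩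
  count (adj K a ∘ punchIn a)  ≡⟨ count-all (adj K a ∘ punchIn a) others ⟩
  s                            ≡⟨ lookup-replicate a s ⟨
  lookup (replicate (suc s) s) a ∎
  where
  open ≡-Reasoning
  K : Graph (suc s)
  K = complete (suc s)
  others : ∀ j → T (adj K a (punchIn a j))
  others j = subst (T ∘ not) (≡-sym (dec-false (a ≟ punchIn a j) (punchInᵢ≢i a j ∘ ≡-sym))) _

matchingAdj : ∀ {m} → Fin m → Fin m → Bool
matchingAdj {2+ m} 0F 1F = true
matchingAdj {2+ m} 1F 0F = true
matchingAdj {2+ m} (suc (suc i)) (suc (suc j)) = matchingAdj i j
matchingAdj _ _ = false

matching : (m : ℕ) → Graph m
matching m = record { adj = matchingAdj ; sym = matching-sym ; irrefl = matching-irrefl }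
  where
  matching-sym : ∀ {m} (i j : Fin m) → matchingAdj i j ≡ matchingAdj j i
  matching-sym {2+ m} 0F 0F = refl
  matching-sym {2+ m} 0F 1F = refl
  matching-sym {2+ m} 0F (suc (suc j)) = refl
  matching-sym {2+ m} 1F 0F = refl
  matching-sym {2+ m} 1F 1F = refl
  matching-sym {2+ m} 1F (suc (suc j)) = refl
  matching-sym {2+ m} (suc (suc i)) 0F = refl
  matching-sym {2+ m} (suc (suc i)) 1F = refl
  matching-sym {2+ m} (suc (suc i)) (suc (suc j)) = matching-sym i j
  matching-sym {1} 0F 0F = refl
  matching-irrefl : ∀ {m} (i : Fin m) → matchingAdj i i ≡ false
  matching-irrefl {2+ m} 0F = refl
  matching-irrefl {2+ m} 1F = refl
  matching-irrefl {2+ m} (suc (suc i)) = matching-irrefl i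
  matching-irrefl {1} 0F = refl

matchingDegrees : (m : ℕ) → Vec ℕ m
matchingDegrees 0      = []
matchingDegrees 1      = 0 ∷ []
matchingDegrees (2+ m) = 1 ∷ 1 ∷ matchingDegrees m

matching-realizes : ∀ m → Realizes (matching m) (matchingDegrees m)
matching-realizes m i = trans (deg≡count (matching m) i) (count-matchingAdj i)
  where
  count-matchingAdj : ∀ {m} (i : Fin m) → count (matchingAdj i) ≡ lookup (matchingDegrees m) i
  count-matchingAdj {2+ m} 0F            = cong suc (count-none {m} (λ _ → false) (λ _ ()))
  count-matchingAdj {2+ m} 1F            = cong suc (count-none {m} (λ _ → false) (λ _ ()))
  count-matchingAdj {2+ m} (suc (suc i)) = count-matchingAdj i
  count-matchingAdj {1}    0F            = refl

matchingDegrees≤1 : ∀ m i → lookup (matchingDegrees m) i ≤ 1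
matchingDegrees≤1 (2+ m) 0F            = ≤-refl
matchingDegrees≤1 (2+ m) 1F            = ≤-refl
matchingDegrees≤1 (2+ m) (suc (suc i)) = matchingDegrees≤1 m i
matchingDegrees≤1 1      0F            = z≤n

matchingDegrees-nonincreasing : ∀ m → Nonincreasing (matchingDegrees m)
matchingDegrees-nonincreasing (2+ m) 0F j _ = matchingDegrees≤1 (2+ m) j
matchingDegrees-nonincreasing (2+ m) 1F j _ = matchingDegrees≤1 (2+ m) j
matchingDegrees-nonincreasing (2+ m) (suc (suc i)) (suc (suc j)) (s≤s (s≤s i≤j)) =
  matchingDegrees-nonincreasing m i j i≤j
matchingDegrees-nonincreasing 1 0F 0F _ = z≤n

σ-matchingDegrees : ∀ m → σ (matchingDegrees m) + m % 2 ≡ m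
σ-matchingDegrees 0      = refl
σ-matchingDegrees 1      = refl
σ-matchingDegrees (2+ m) = cong 2+ (σ-matchingDegrees m)

module _ {s m : ℕ} (G : Graph s) (L : Graph m) where

  private
    joinAdj : Fin s ⊎ Fin m → Fin s ⊎ Fin m → Bool
    joinAdj (inj₁ a) (inj₁ a′) = adj G a a′
    joinAdj (inj₂ b) (inj₂ b′) = adj L b b′
    joinAdj _        _         = true

    joinAdj-sym : ∀ x y → joinAdj x y ≡ joinAdj y x
    joinAdj-sym (inj₁ a) (inj₁ a′) = sym G a a′
    joinAdj-sym (inj₁ a) (inj₂ b′) = refl
    joinAdj-sym (inj₂ b) (inj₁ a′) = refl
    joinAdj-sym (inj₂ b) (inj₂ b′) = sym L b b′

    joinAdj-irrefl : ∀ x → joinAdj x x ≡ false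
    joinAdj-irrefl (inj₁ a) = irrefl G a
    joinAdj-irrefl (inj₂ b) = irrefl L b

  join : Graph (s + m)
  join = record
    { adj    = λ x y → joinAdj (splitAt s x) (splitAt s y)
    ; sym    = λ x y → joinAdj-sym (splitAt s x) (splitAt s y)
    ; irrefl = λ x → joinAdj-irrefl (splitAt s x)
    }

  deg-join-↑ˡ : ∀ a → deg join (a ↑ˡ m) ≡ m + deg G a
  deg-join-↑ˡ a = begin
    deg join (a ↑ˡ m)                                                        ≡⟨ deg≡count join (a ↑ˡ m) ⟩
    count (adj join (a ↑ˡ m))                                                ≡⟨ count-split s (adj join (a ↑ˡ m)) ⟩
    count (adj join (a ↑ˡ m) ∘ (_↑ˡ m)) + count (adj join (a ↑ˡ m) ∘ (s ↑ʳ_)) ≡⟨ cong₂ _+_ (count-cong ˡˡ) (count-all _ ˡʳ) ⟩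
    count (adj G a) + m                                                      ≡⟨ +-comm _ m ⟩
    m + count (adj G a)                                                      ≡⟨ cong (m +_) (deg≡count G a) ⟨
    m + deg G a                                                              ∎
    where
    open ≡-Reasoning
    ˡˡ : ∀ a′ → adj join (a ↑ˡ m) (a′ ↑ˡ m) ≡ adj G a a′
    ˡˡ a′ = cong₂ joinAdj (splitAt-↑ˡ s a m) (splitAt-↑ˡ s a′ m)
    ˡʳ : ∀ b → T (adj join (a ↑ˡ m) (s ↑ʳ b))
    ˡʳ b = subst T (≡-sym (cong₂ joinAdj (splitAt-↑ˡ s a m) (splitAt-↑ʳ s m b))) _

  deg-join-↑ʳ : ∀ b → deg join (s ↑ʳ b) ≡ s + deg L b
  deg-join-↑ʳ b = begin
    deg join (s ↑ʳ b)                                                        ≡⟨ deg≡count join (s ↑ʳ b) ⟩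
    count (adj join (s ↑ʳ b))                                                ≡⟨ count-split s (adj join (s ↑ʳ b)) ⟩
    count (adj join (s ↑ʳ b) ∘ (_↑ˡ m)) + count (adj join (s ↑ʳ b) ∘ (s ↑ʳ_)) ≡⟨ cong₂ _+_ (count-all _ ʳˡ) (count-cong ʳʳ) ⟩
    s + count (adj L b)                                                      ≡⟨ cong (s +_) (deg≡count L b) ⟨
    s + deg L b                                                              ∎
    where
    open ≡-Reasoning
    ʳˡ : ∀ a → T (adj join (s ↑ʳ b) (a ↑ˡ m))
    ʳˡ a = subst T (≡-sym (cong₂ joinAdj (splitAt-↑ʳ s m b) (splitAt-↑ˡ s a m))) _
    ʳʳ : ∀ b′ → adj join (s ↑ʳ b) (s ↑ʳ b′) ≡ adj L b b′
    ʳʳ b′ = cong₂ joinAdj (splitAt-↑ʳ s m b) (splitAt-↑ʳ s m b′)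

  join-realizes : ∀ {xs ys} → Realizes G xs → Realizes L ys → Realizes join (map (m +_) xs ++ map (s +_) ys)
  join-realizes {xs} {ys} G-realizes L-realizes i with splitView s i
  ... | left a = begin
    deg join (a ↑ˡ m)                         ≡⟨ deg-join-↑ˡ a ⟩
    m + deg G a                               ≡⟨ cong (m +_) (G-realizes a) ⟩
    m + lookup xs a                           ≡⟨ lookup-map a (m +_) xs ⟨
    lookup (map (m +_) xs) a                  ≡⟨ lookup-++ˡ (map (m +_) xs) (map (s +_) ys) a ⟨
    lookup (map (m +_) xs ++ map (s +_) ys) (a ↑ˡ m) ∎
    where open ≡-Reasoning
  ... | right b = begin
    deg join (s ↑ʳ b)                         ≡⟨ deg-join-↑ʳ b ⟩
    s + deg L b                               ≡⟨ cong (s +_) (L-realizes b) ⟩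
    s + lookup ys b                           ≡⟨ lookup-map b (s +_) ys ⟨
    lookup (map (s +_) ys) b                  ≡⟨ lookup-++ʳ (map (m +_) xs) (map (s +_) ys) b ⟨
    lookup (map (m +_) xs ++ map (s +_) ys) (s ↑ʳ b) ∎
    where open ≡-Reasoning

++-nonincreasing : ∀ {s m} (xs : Vec ℕ s) (ys : Vec ℕ m) → Nonincreasing xs → Nonincreasing ys →
  (∀ a b → lookup ys b ≤ lookup xs a) → Nonincreasing (xs ++ ys)
++-nonincreasing {s} {m} xs ys xs↓ ys↓ ys≤xs i j i≤j with splitView s i | splitView s j
... | left a  | left a′  rewrite lookup-++ˡ xs ys a | lookup-++ˡ xs ys a′ =
  xs↓ a a′ (subst₂ _≤_ (toℕ-↑ˡ a m) (toℕ-↑ˡ a′ m) i≤j)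
... | left a  | right b  rewrite lookup-++ˡ xs ys a | lookup-++ʳ xs ys b = ys≤xs a b
... | right b | right b′ rewrite lookup-++ʳ xs ys b | lookup-++ʳ xs ys b′ =
  ys↓ b b′ (+-cancelˡ-≤ s _ _ (subst₂ _≤_ (toℕ-↑ʳ s b) (toℕ-↑ʳ s b′) i≤j))
... | right b | left a   = ⊥-elim (<⇒≱ (toℕ<n a) (begin
  s                ≤⟨ m≤m+n s (toℕ b) ⟩
  s + toℕ b        ≡⟨ toℕ-↑ʳ s b ⟨
  toℕ (s ↑ʳ b)     ≤⟨ i≤j ⟩
  toℕ (a ↑ˡ m)     ≡⟨ toℕ-↑ˡ a m ⟩
  toℕ a            ∎))
  where open ≤-Reasoning

map-+-nonincreasing : ∀ {n} c (xs : Vec ℕ n) → Nonincreasing xs → Nonincreasing (map (c +_) xs)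
map-+-nonincreasing c xs xs↓ i j i≤j rewrite lookup-map i (c +_) xs | lookup-map j (c +_) xs =
  +-monoʳ-≤ c (xs↓ i j i≤j)

replicate-nonincreasing : ∀ n x → Nonincreasing (replicate n x)
replicate-nonincreasing n x i j _ rewrite lookup-replicate i x | lookup-replicate j x = ≤-refl

sum-replicate : ∀ n x → sum (replicate n x) ≡ n * x
sum-replicate zero    x = refl
sum-replicate (suc n) x = cong (x +_) (sum-replicate n x)

sum-map-+ : ∀ {n} c (xs : Vec ℕ n) → sum (map (c +_) xs) ≡ n * c + sum xs
sum-map-+ c []       = refl
sum-map-+ c (x ∷ xs) = trans (cong (c + x +_) (sum-map-+ c xs)) (interchange c x _ _)

extremal : (s m : ℕ) → Vec ℕ (s + m)
extremal s m = map (m +_) (replicate s (s ∸ 1)) ++ map (s +_) (matchingDegrees m)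

extremal-graphic : ∀ s m → 2 ≤ m → Graphic (extremal s m)
extremal-graphic s m 2≤m =
  ++-nonincreasing high low (map-+-nonincreasing m (replicate s (s ∸ 1)) (replicate-nonincreasing s (s ∸ 1)))
                   (map-+-nonincreasing s (matchingDegrees m) (matchingDegrees-nonincreasing m)) low≤high ,
  join (complete s) (matching m) ,
  join-realizes (complete s) (matching m) {replicate s (s ∸ 1)} {matchingDegrees m}
                (complete-realizes s) (matching-realizes m)
  where
  high : Vec ℕ s
  high = map (m +_) (replicate s (s ∸ 1))
  low : Vec ℕ m
  low = map (s +_) (matchingDegrees m)
  low≤high : ∀ a b → lookup low b ≤ lookup high a
  low≤high a b rewrite lookup-map b (s +_) (matchingDegrees m) | lookup-map a (m +_) (replicate s (s ∸ 1))
                     | lookup-replicate a (s ∸ 1) = s+d≤m+[s∸1] a (matchingDegrees≤1 m b)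
    where
    s+d≤m+[s∸1] : ∀ {s d} → Fin s → d ≤ 1 → s + d ≤ m + (s ∸ 1)
    s+d≤m+[s∸1] {suc s} {d} _ d≤1 = begin
      suc s + d   ≤⟨ +-monoʳ-≤ (suc s) d≤1 ⟩
      suc s + 1   ≡⟨ +-comm (suc s) 1 ⟩
      2 + s       ≤⟨ +-monoˡ-≤ s 2≤m ⟩
      m + s       ∎
      where open ≤-Reasoning

extremal-high : ∀ s m a → lookup (extremal s m) (a ↑ˡ m) ≡ s + m ∸ 1
extremal-high (suc s) m a = begin
  lookup (extremal (suc s) m) (a ↑ˡ m)    ≡⟨ lookup-++ˡ (map (m +_) (replicate (suc s) s)) (map (suc s +_) (matchingDegrees m)) a ⟩
  lookup (map (m +_) (replicate (suc s) s)) a ≡⟨ lookup-map a (m +_) (replicate (suc s) s) ⟩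
  m + lookup (replicate (suc s) s) a      ≡⟨ cong (m +_) (lookup-replicate a s) ⟩
  m + s                                   ≡⟨ +-comm m s ⟩
  s + m                                   ∎
  where open ≡-Reasoning

extremal-low : ∀ s m b → lookup (extremal s m) (s ↑ʳ b) ≤ s + 1
extremal-low s m b = begin
  lookup (extremal s m) (s ↑ʳ b)          ≡⟨ lookup-++ʳ (map (m +_) (replicate s (s ∸ 1))) (map (s +_) (matchingDegrees m)) b ⟩
  lookup (map (s +_) (matchingDegrees m)) b ≡⟨ lookup-map b (s +_) (matchingDegrees m) ⟩
  s + lookup (matchingDegrees m) b        ≤⟨ +-monoʳ-≤ s (matchingDegrees≤1 m b) ⟩
  s + 1                                   ∎
  where open ≤-Reasoning

σ-extremal : ∀ s m → σ (extremal s m) + m % 2 ≡ s * m + s * (s ∸ 1) + (m * s + m)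
σ-extremal s m = begin
  σ (extremal s m) + m % 2
    ≡⟨ cong (_+ m % 2) (sum-++ (map (m +_) (replicate s (s ∸ 1)))) ⟩
  σ (map (m +_) (replicate s (s ∸ 1))) + σ (map (s +_) (matchingDegrees m)) + m % 2
    ≡⟨ cong₂ (λ x y → x + y + m % 2)
             (trans (sum-map-+ m (replicate s (s ∸ 1))) (cong (s * m +_) (sum-replicate s (s ∸ 1))))
             (sum-map-+ s (matchingDegrees m)) ⟩
  s * m + s * (s ∸ 1) + (m * s + σ (matchingDegrees m)) + m % 2
    ≡⟨ +-assoc (s * m + s * (s ∸ 1)) _ _ ⟩
  s * m + s * (s ∸ 1) + (m * s + σ (matchingDegrees m) + m % 2)
    ≡⟨ cong (λ x → s * m + s * (s ∸ 1) + x) (trans (+-assoc (m * s) _ _) (cong (m * s +_) (σ-matchingDegrees m))) ⟩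
  s * m + s * (s ∸ 1) + (m * s + m)
    ∎
  where open ≡-Reasoning

-- The extremal sequence is not potentially (K_{s+4} − H)-graphic

↑ˡ≢↑ʳ : ∀ {s m} (a : Fin s) (b : Fin m) → a ↑ˡ m ≢ s ↑ʳ b
↑ˡ≢↑ʳ {s} {m} a b eq with trans (≡-sym (splitAt-↑ˡ s a m)) (trans (cong (splitAt s) eq) (splitAt-↑ʳ s m b))
... | ()

module _ {s m : ℕ} where

  Low : Fin (s + m) → Set
  Low x = Σ (Fin m) λ b → x ≡ s ↑ʳ b

  isLow : Fin (s + m) → Bool
  isLow x = [ const false , const true ]′ (splitAt s x)

  isLow⇒Low : ∀ {x} → T (isLow x) → Low x
  isLow⇒Low {x} x-low with splitView s x
  ... | left a  rewrite splitAt-↑ˡ s a m = ⊥-elim x-low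
  ... | right b = b , refl

  count-high : count (not ∘ isLow) ≡ s
  count-high = begin
    count (not ∘ isLow)                                       ≡⟨ count-split s (not ∘ isLow) ⟩
    count (not ∘ isLow ∘ (_↑ˡ m)) + count (not ∘ isLow ∘ (s ↑ʳ_)) ≡⟨ cong₂ _+_ (count-all _ high) (count-none _ low) ⟩
    s + 0                                                     ≡⟨ +-identityʳ s ⟩
    s                                                         ∎
    where
    open ≡-Reasoning
    high : ∀ a → T (not (isLow (a ↑ˡ m)))
    high a rewrite splitAt-↑ˡ s a m = _
    low : ∀ b → ¬ T (not (isLow (s ↑ʳ b)))
    low b rewrite splitAt-↑ʳ s m b = λ ()

  low-preimages : ∀ {N} (f : Fin N → Fin (s + m)) → Injective _≡_ _≡_ f → s + 4 ≤ N →
    Σ (Fin 4 → Fin N) λ y → Injective _≡_ _≡_ y × (∀ i → Low (f (y i)))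
  low-preimages {N} f f-inj s+4≤N =
    let y , y-inj , y-low = count-choose 4 (isLow ∘ f) 4≤low in y , y-inj , isLow⇒Low ∘ y-low
    where
    4≤low : 4 ≤ count (isLow ∘ f)
    4≤low = +-cancelʳ-≤ s 4 _ (begin
      4 + s                                           ≡⟨ +-comm 4 s ⟩
      s + 4                                           ≤⟨ s+4≤N ⟩
      N                                               ≡⟨ count-complement (isLow ∘ f) ⟨
      count (isLow ∘ f) + count (not ∘ isLow ∘ f)     ≤⟨ +-monoʳ-≤ (count (isLow ∘ f)) (count-∘-injective (not ∘ isLow) f f-inj) ⟩
      count (isLow ∘ f) + count (not ∘ isLow)         ≡⟨ cong (count (isLow ∘ f) +_) count-high ⟩
      count (isLow ∘ f) + s                           ∎)
      where open ≤-Reasoning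

  module _ (π : Vec ℕ (s + m))
           (π-high : ∀ a → lookup π (a ↑ˡ m) ≡ s + m ∸ 1) (π-low : ∀ b → lookup π (s ↑ʳ b) ≤ s + 1) where

    low-part-sparse : ∀ {G} → Realizes G π → MaxDegree≤1On G Low
    low-part-sparse {G} G-realizes {u} (b , refl) (c , refl) (c′ , refl) v≢w uv uw = 2≰1 (+-cancelˡ-≤ s 2 1 (begin
      s + 2                                                   ≤⟨ +-monoʳ-≤ s (2≤count (adj G u ∘ (s ↑ʳ_)) (v≢w ∘ cong (s ↑ʳ_)) uv uw) ⟩
      s + count (adj G u ∘ (s ↑ʳ_))                           ≡⟨ cong (_+ count (adj G u ∘ (s ↑ʳ_))) high-neighbours ⟨
      count (adj G u ∘ (_↑ˡ m)) + count (adj G u ∘ (s ↑ʳ_))   ≡⟨ count-split s (adj G u) ⟨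
      count (adj G u)                                         ≡⟨ deg≡count G u ⟨
      deg G u                                                 ≡⟨ G-realizes u ⟩
      lookup π u                                              ≤⟨ π-low b ⟩
      s + 1                                                   ∎))
      where
      open ≤-Reasoning
      2≰1 : ¬ 2 ≤ 1
      2≰1 (s≤s ())
      high-neighbours : count (adj G u ∘ (_↑ˡ m)) ≡ s
      high-neighbours = count-all _ λ a →
        subst T (sym G _ _) (deg≡n∸1⇒adjacent G (trans (G-realizes (a ↑ˡ m)) (π-high a)) (↑ˡ≢↑ʳ a b))

    ¬PotentiallyGraphic-KminusH : ∀ {k N} (H : Graph k) → ¬ ContainsC4 H → s + 4 ≤ N →
      ¬ PotentiallyGraphic (KminusH {k} {N} H) π
    ¬PotentiallyGraphic-KminusH H C4⊈H s+4≤N (G , G-realizes , embedding@(f , f-inj , _)) =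
      let y , y-inj , y-low = low-preimages f f-inj s+4≤N
      in C4⊈H (KminusH-sparse⇒C4 H y y-inj y-low
                 (MaxDegree≤1On-pullback {F = KminusH H} {G = G} {S = Low} embedding (low-part-sparse {G} G-realizes)))

3+s≤n⇒∃[t]s+[3+t]≡n : ∀ {s n} → 3 + s ≤ n → ∃ λ t → s + (3 + t) ≡ n
3+s≤n⇒∃[t]s+[3+t]≡n {s} 3+s≤n =
  let t , 3+s+t≡n = m≤n⇒∃[o]m+o≡n 3+s≤n in t , trans (x∙yz≈y∙xz s 3 t) 3+s+t≡n

s+[3+t]∸[3+s]≡t : ∀ s t → s + (3 + t) ∸ (3 + s) ≡ t
s+[3+t]∸[3+s]≡t s t = trans (cong (s + (3 + t) ∸_) (+-comm 3 s)) ([m+n]∸[m+o]≡n∸o s (3 + t) 3)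

bound≡ : ∀ s t → let m = 3 + t; n = s + m; r = 3 + s in
  (r ∸ 1) * (2 * n ∸ r) ∸ 3 * (n ∸ r) ≡ 3 + (s * m + s * (s ∸ 1) + (m * s + m))
bound≡ s t = begin
  (2 + s) * (2 * (s + (3 + t)) ∸ (3 + s)) ∸ 3 * (s + (3 + t) ∸ (3 + s))
    ≡⟨ cong₂ (λ x y → (2 + s) * x ∸ 3 * y) 2n∸r (s+[3+t]∸[3+s]≡t s t) ⟩
  (2 + s) * (s + (3 + 2 * t)) ∸ 3 * t
    ≡⟨ cong (_∸ 3 * t) (polynomial s t) ⟩
  3 + (s * (3 + t) + s * (s ∸ 1) + ((3 + t) * s + (3 + t))) + 3 * t ∸ 3 * t
    ≡⟨ m+n∸n≡m _ (3 * t) ⟩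
  3 + (s * (3 + t) + s * (s ∸ 1) + ((3 + t) * s + (3 + t)))
    ∎
  where
  open ≡-Reasoning
  2n∸r : 2 * (s + (3 + t)) ∸ (3 + s) ≡ s + (3 + 2 * t)
  2n∸r = trans (cong (_∸ (3 + s)) (double s t)) (m+n∸m≡n (3 + s) _)
    where
    double : ∀ s t → 2 * (s + (3 + t)) ≡ 3 + s + (s + (3 + 2 * t))
    double = solve-∀
  -- s * (s ∸ 1) only becomes a polynomial once s is split into zero and suc.
  polynomial : ∀ s t →
    (2 + s) * (s + (3 + 2 * t)) ≡ 3 + (s * (3 + t) + s * (s ∸ 1) + ((3 + t) * s + (3 + t))) + 3 * t
  polynomial zero    = solve-∀
  polynomial (suc s) = at-suc s
    where
    at-suc : ∀ s t →
      (3 + s) * (suc s + (3 + 2 * t)) ≡ 3 + (suc s * (3 + t) + suc s * s + ((3 + t) * suc s + (3 + t))) + 3 * t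
    at-suc = solve-∀

-- p is the parity of n − r, so the subtracted 1 + (1 + p) % 2 is 1 when n − r is odd and 2 when it is even.
extremal-SigmaGeq : ∀ {k} s t (H : Graph k) → ¬ ContainsC4 H → let n = s + (3 + t); r = 3 + s in
  ∀ {p} → (n ∸ r) % 2 ≡ p →
  SigmaGeq (KminusH {k} {r + 1} H) n ((r ∸ 1) * (2 * n ∸ r) ∸ 3 * (n ∸ r) ∸ (1 + (1 + p) % 2))
extremal-SigmaGeq s t H C4⊈H {p} [n∸r]%2≡p = subst (SigmaGeq (KminusH H) (s + m)) (≡-sym bound≡2+σπ) σ-bound
  where
  m : ℕ
  m = 3 + t
  π : Vec ℕ (s + m)
  π = extremal s m
  σ-bound : SigmaGeq (KminusH H) (s + m) (2 + σ π)
  σ-bound = non-potential⇒SigmaGeq {H = KminusH H} {π = π} (extremal-graphic s m (s≤s (s≤s z≤n)))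
    (¬PotentiallyGraphic-KminusH π (extremal-high s m) (extremal-low s m) H C4⊈H (≤-reflexive (x∙yz≈y∙xz s 3 1)))
  m%2≡[1+p]%2 : m % 2 ≡ (1 + p) % 2
  m%2≡[1+p]%2 = trans (%-distribˡ-+ 1 t 2)
    (cong (λ x → (1 + x) % 2) (trans (cong (_% 2) (≡-sym (s+[3+t]∸[3+s]≡t s t))) [n∸r]%2≡p))
  bound≡2+σπ : (2 + s) * (2 * (s + m) ∸ (3 + s)) ∸ 3 * (s + m ∸ (3 + s)) ∸ (1 + (1 + p) % 2) ≡ 2 + σ π
  bound≡2+σπ = begin
    (2 + s) * (2 * (s + m) ∸ (3 + s)) ∸ 3 * (s + m ∸ (3 + s)) ∸ (1 + (1 + p) % 2)
      ≡⟨ cong₂ (λ x y → x ∸ (1 + y)) (bound≡ s t) (≡-sym m%2≡[1+p]%2) ⟩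
    3 + (s * m + s * (s ∸ 1) + (m * s + m)) ∸ (1 + m % 2)
      ≡⟨ cong (λ x → 2 + x ∸ m % 2) (σ-extremal s m) ⟨
    2 + σ π + m % 2 ∸ m % 2
      ≡⟨ m+n∸n≡m (2 + σ π) (m % 2) ⟩
    2 + σ π
      ∎
    where open ≡-Reasoning

lemma3p7 : (n r k : ℕ) → n ≥ r + 1 → r + 1 ≥ k → k ≥ 4 →
    (H : Graph k) → ¬ ContainsC4 H →
    ((n ∸ r) % 2 ≡ 1 →
      SigmaGeq (KminusH {k} {r + 1} H) n ((r ∸ 1) * (2 * n ∸ r) ∸ 3 * (n ∸ r) ∸ 1)) ×
    ((n ∸ r) % 2 ≡ 0 →
      SigmaGeq (KminusH {k} {r + 1} H) n ((r ∸ 1) * (2 * n ∸ r) ∸ 3 * (n ∸ r) ∸ 2))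
lemma3p7 n r k n≥r+1 r+1≥k k≥4 H C4⊈H
  with s , refl ← m≤n⇒∃[o]m+o≡n (+-cancelʳ-≤ 1 3 r (≤-trans k≥4 r+1≥k))
  with t , refl ← 3+s≤n⇒∃[t]s+[3+t]≡n (m+n≤o⇒m≤o (3 + s) n≥r+1)
  = extremal-SigmaGeq s t H C4⊈H , extremal-SigmaGeq s t H C4⊈H
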